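{- For $n\ge1$ let $t_n(u)=\sum_{D}u^{\operatorname{des}(D)}$, where the sum is over all strongly connected tournaments $D$ on the vertex set $[n]=\{1,\dots,n\}$. Then the polynomial $t_n(u)$ is divisible by $(1+u)^{\lfloor n/2\rfloor}$ in $\mathbb{Z}[u]$.
   Context: A digraph on a finite set $V$ of integers is a set of ordered pairs $(s,t)\in V\times V$ with $s\ne t$. A tournament is a digraph with exactly one of $(s,t)$, $(t,s)$ as an edge for each pair $s\neq t$. A digraph is strongly connected if for every two vertices $a,b$ there is a directed path from $a$ to $b$ (the empty path allowed when $a=b$). A descent of a digraph is an edge $(s,t)$ with $s>t$; $\operatorname{des}(D)$ is the number of descents of $D$. -}

module Defs where

open import Data.Nat using (ℕ; zero; suc; _<_; _<ᵇ_)
open import Data.Bool using (Bool; true; false; _∧_; if_then_else_)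
open import Data.Fin using (Fin; toℕ)
open import Data.Vec using (Vec; lookup)
open import Data.List using (List; []; _∷_; length; map; allFin)
open import Data.Nat.ListAction using (sum)
open import Data.List.Relation.Unary.Unique.Propositional using (Unique)
open import Data.List.Membership.Propositional using (_∈_)
open import Data.Integer using (ℤ; +_; _+_)
open import Data.Product using (Σ; _×_)
open import Relation.Binary.PropositionalEquality using (_≡_; _≢_)
open import Relation.Nullary using (¬_)
open import Data.Sum using (_⊎_)
open import Function.Bundles using (_⇔_)

-- Digraphs on the vertex set Fin n (= {0,…,n-1}, order-isomorphic to [n]),
-- given by their adjacency matrix: (s,t) is an edge iff M[s][t] = true.

Digraph : ℕ → Set
Digraph n = Vec (Vec Bool n) n

Edge : ∀ {n} → Digraph n → Fin n → Fin n → Set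
Edge M s t = lookup (lookup M s) t ≡ true

Loopless : ∀ {n} → Digraph n → Set
Loopless M = ∀ s → ¬ Edge M s s

IsTournament : ∀ {n} → Digraph n → Set
IsTournament M =
  Loopless M ×
  (∀ s t → s ≢ t → (Edge M s t × ¬ Edge M t s) ⊎ (Edge M t s × ¬ Edge M s t))

data Path {n} (M : Digraph n) : Fin n → Fin n → Set where
  here : ∀ {a} → Path M a a
  step : ∀ {a b c} → Edge M a b → Path M b c → Path M a c

StronglyConnected : ∀ {n} → Digraph n → Set
StronglyConnected M = ∀ a b → Path M a b

des : ∀ {n} → Digraph n → ℕ
des {n} M = sum (map (λ s → sum (map (λ t →
  if (toℕ t <ᵇ toℕ s) ∧ lookup (lookup M s) t then 1 else 0) (allFin n))) (allFin n))

-- "m is the number of elements of A satisfying P":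
-- there is a duplicate-free list of exactly the elements satisfying P, of length m.
IsCount : {A : Set} → (A → Set) → ℕ → Set
IsCount {A} P m = Σ (List A) λ L → Unique L × (∀ x → (x ∈ L) ⇔ P x) × (length L ≡ m)

-- Polynomials in ℤ[u] as coefficient lists (constant term first).

coef : List ℤ → ℕ → ℤ
coef [] _ = + 0
coef (a ∷ p) zero = a
coef (a ∷ p) (suc k) = coef p k

_+ₚ_ : List ℤ → List ℤ → List ℤ
[] +ₚ q = q
(a ∷ p) +ₚ [] = a ∷ p
(a ∷ p) +ₚ (b ∷ q) = (a + b) ∷ (p +ₚ q)

mul1+u : List ℤ → List ℤ
mul1+u p = p +ₚ (+ 0 ∷ p)

mul[1+u]^ : ℕ → List ℤ → List ℤ
mul[1+u]^ zero p = p
mul[1+u]^ (suc m) p = mul1+u (mul[1+u]^ m p)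

-- Relabelling a tournament by the transposition of two adjacent vertices a and a + 1 keeps it a
-- strongly connected tournament, reverses the edge between a and a + 1 and leaves the relative
-- order of every other pair of endpoints unchanged, so it changes the number of descents by
-- exactly one. Let c_P(k) count the strong tournaments with k descents in which every pair of a
-- family P of disjoint adjacent pairs is oriented upwards. For an adjacent pair p disjoint from
-- P, the transposition of p matches the tournaments counted by c_{P ∪ {p}}(k - 1) with those
-- counted by c_P(k) in which p is oriented downwards, hence
-- c_P(k) = c_{P ∪ {p}}(k) + c_{P ∪ {p}}(k - 1), i.e. the generating function of c_P is (1 + u)
-- times that of c_{P ∪ {p}}. Adding the ⌊n/2⌋ pairs {2i, 2i + 1} one at a time gives the theorem.

module Submission where

open import Defs
open import Data.Nat using (ℕ; zero; suc; _+_; _*_; _<_; _≤_; _/_; _<ᵇ_; z≤n; s≤s; s≤s⁻¹)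
open import Data.Nat.Properties
  using ( +-*-semiring; _<?_; +-identityʳ; +-comm; *-assoc; *-distribʳ-+; *-identityʳ; +-mono-≤
        ; suc-injective; 0≢1+n; <-irrefl; <-trans; <⇒≤; <⇒≱; <⇒≯; ≤-reflexive; ≤∧≢⇒<
        ; n<1+n; m<n⇒m<1+n )
open import Data.Nat.DivMod using (m/n*n≤m)
import Data.Nat.ListAction as ListAction
open import Data.Integer using (ℤ; +_) renaming (_+_ to _+ℤ_)
open import Data.Integer.Properties
  using (pos-+) renaming (+-identityˡ to +ℤ-identityˡ; +-identityʳ to +ℤ-identityʳ)
open import Data.Bool using (Bool; true; false; _∧_; if_then_else_)
import Data.Bool.Properties as Bool
open import Data.Fin using (Fin; toℕ; fromℕ<) renaming (zero to fzero; suc to fsuc)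
open import Data.Fin.Properties using (_≟_; toℕ-injective; toℕ-fromℕ<; <⇒≢)
open import Data.Fin.Permutation using (Permutation; _⟨$⟩ʳ_; _⟨$⟩ˡ_; inverseˡ; inverseʳ)
import Data.Fin.Permutation as Perm
import Data.Fin.Permutation.Components as PC
open import Data.Vec using (lookup; tabulate)
open import Data.Vec.Properties using (lookup∘tabulate; tabulate∘lookup; tabulate-cong)
open import Data.List using (List; []; _∷_; _++_; length; map; filter; allFin)
import Data.List as List
open import Data.List.Properties using (length-map; length-++; map-tabulate; map-cong)
open import Data.List.Membership.Propositional using (_∈_)
open import Data.List.Membership.Propositional.Properties
  using (∈-map⁺; ∈-map⁻; ∈-filter⁺; ∈-filter⁻; ++-∈⇔)
open import Data.List.Membership.Propositional.Properties.WithK using (unique∧set⇒bag)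
open import Data.List.Relation.Binary.BagAndSetEquality using (∼bag⇒↭)
open import Data.List.Relation.Binary.Permutation.Propositional.Properties using (↭-length)
open import Data.List.Relation.Unary.All as All using (All; []; _∷_)
open import Data.List.Relation.Unary.AllPairs using (AllPairs; []; _∷_)
open import Data.List.Relation.Unary.Unique.Propositional.Properties using (map⁺; filter⁺; ++⁺)
open import Data.Product using (Σ; _×_; _,_; proj₁; proj₂)
open import Data.Sum using (_⊎_; inj₁; inj₂; [_,_]′)
import Data.Sum as Sum
open import Data.Empty using (⊥; ⊥-elim)
open import Function using (id; _∘_)
open import Function.Bundles using (_⇔_; mk⇔; Equivalence)
open import Function.Construct.Composition using (_⇔-∘_)
open import Function.Construct.Symmetry using (⇔-sym)
open import Relation.Binary.PropositionalEquality
open import Relation.Nullary using (¬_; does; yes; no; contradiction)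
open import Relation.Nullary.Decidable using (dec-true; dec-false)
open import Relation.Unary using (Decidable)
open import Algebra.Properties.Semiring.Sum +-*-semiring
  using (sum-syntax; sum-replicate-zero; sum-cong-≗; ∑-permute; ∑-distrib-+; *-distribˡ-sum)

open Equivalence using (to; from)

private variable n : ℕ

module _ {A : Set} {P : A → Set} where

  IsCount-unique : ∀ {m m′} → IsCount P m → IsCount P m′ → m ≡ m′
  IsCount-unique (xs , !xs , ∈xs , refl) (ys , !ys , ∈ys , refl) =
    ↭-length (∼bag⇒↭ (unique∧set⇒bag !xs !ys (λ {x} → ⇔-sym (∈ys x) ⇔-∘ ∈xs x)))

  IsCount-resp : ∀ {Q : A → Set} {m} → (∀ x → P x ⇔ Q x) → IsCount P m → IsCount Q m
  IsCount-resp P⇔Q (xs , !xs , ∈xs , |xs|) = xs , !xs , (λ x → P⇔Q x ⇔-∘ ∈xs x) , |xs|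

  IsCount-∅ : (∀ x → ¬ P x) → IsCount P 0
  IsCount-∅ ¬P = [] , [] , (λ x → mk⇔ (λ ()) (⊥-elim ∘ ¬P x)) , refl

  IsCount-∩ : ∀ {m} {Q : A → Set} → Decidable Q → IsCount P m →
    Σ ℕ (IsCount (λ x → P x × Q x))
  IsCount-∩ Q? (xs , !xs , ∈xs , _) = length (filter Q? xs) , filter Q? xs , filter⁺ Q? !xs ,
    (λ x → mk⇔ (λ x∈ → let x∈xs , qx = ∈-filter⁻ Q? x∈ in to (∈xs x) x∈xs , qx)
               (λ (px , qx) → ∈-filter⁺ Q? (from (∈xs x) px) qx)) , refl

  IsCount-split : ∀ {Q : A → Set} {m m₁ m₂} → Decidable Q → IsCount P m
    → IsCount (λ x → P x × Q x) m₁ → IsCount (λ x → P x × ¬ Q x) m₂ → m ≡ m₁ + m₂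
  IsCount-split {Q} Q? P-count (xs , !xs , ∈xs , refl) (ys , !ys , ∈ys , refl) =
    IsCount-unique P-count (xs ++ ys , ++⁺ !xs !ys disjoint , ∈xs++ys , length-++ xs)
    where
    disjoint : ∀ {x} → x ∈ xs × x ∈ ys → ⊥
    disjoint (x∈xs , x∈ys) = proj₂ (to (∈ys _) x∈ys) (proj₂ (to (∈xs _) x∈xs))
    ∈xs++ys : ∀ x → x ∈ xs ++ ys ⇔ P x
    ∈xs++ys x = mk⇔
      ([ proj₁ ∘ to (∈xs x) , proj₁ ∘ to (∈ys x) ]′ ∘ to ++-∈⇔)
      (from ++-∈⇔ ∘ sort)
      where
      sort : P x → x ∈ xs ⊎ x ∈ ys
      sort px with Q? x
      ... | yes qx = inj₁ (from (∈xs x) (px , qx))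
      ... | no ¬qx = inj₂ (from (∈ys x) (px , ¬qx))

IsCount-bijection : ∀ {A B : Set} {P : A → Set} {Q : B → Set} {m} (f : A → B) (g : B → A)
  → (∀ x → g (f x) ≡ x) → (∀ y → f (g y) ≡ y)
  → (∀ {x} → P x → Q (f x)) → (∀ {y} → Q y → P (g y))
  → IsCount P m → IsCount Q m
IsCount-bijection {Q = Q} f g gf fg P⇒Q Q⇒P (xs , !xs , ∈xs , |xs|) =
  map f xs , map⁺ f-injective !xs , ∈map , trans (length-map f xs) |xs|
  where
  f-injective : ∀ {x x′} → f x ≡ f x′ → x ≡ x′
  f-injective {x} {x′} e = trans (sym (gf x)) (trans (cong g e) (gf x′))
  ∈map : ∀ y → y ∈ map f xs ⇔ Q y
  ∈map y = mk⇔
    (λ y∈ → let x , x∈xs , y≡fx = ∈-map⁻ f y∈ in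
             subst Q (sym y≡fx) (P⇒Q (to (∈xs x) x∈xs)))
    (λ qy → subst (_∈ map f xs) (fg y) (∈-map⁺ f (from (∈xs (g y)) (Q⇒P qy))))

<ᵇ-true : ∀ {m n} → m < n → (m <ᵇ n) ≡ true
<ᵇ-true {m} {n} = dec-true (m <? n)

<ᵇ-false : ∀ {m n} → ¬ m < n → (m <ᵇ n) ≡ false
<ᵇ-false {m} {n} = dec-false (m <? n)

<ᵇ-irrefl : ∀ m → (m <ᵇ m) ≡ false
<ᵇ-irrefl m = <ᵇ-false {m} (<-irrefl refl)

<ᵇ-cong : ∀ {m n m′ n′} → (m < n → m′ < n′) → (m′ < n′ → m < n) →
  (m <ᵇ n) ≡ (m′ <ᵇ n′)
<ᵇ-cong {m} {n} ⇒ ⇐ with m <? n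
... | yes m<n = trans (<ᵇ-true m<n) (sym (<ᵇ-true (⇒ m<n)))
... | no m≮n = trans (<ᵇ-false m≮n) (sym (<ᵇ-false (m≮n ∘ ⇐)))

ind : Bool → ℕ
ind b = if b then 1 else 0

ind-∧ : ∀ x y → ind (x ∧ y) ≡ ind x * ind y
ind-∧ false y = refl
ind-∧ true y = sym (+-identityʳ (ind y))

ind-≤ : ∀ b → ind b ≤ 1
ind-≤ false = z≤n
ind-≤ true = s≤s z≤n

sum-tabulate : (f : Fin n → ℕ) → ListAction.sum (List.tabulate f) ≡ ∑[ i < n ] f i
sum-tabulate {zero} f = refl
sum-tabulate {suc n} f = cong (_+_ (f fzero)) (sum-tabulate (f ∘ fsuc))

sum-map-allFin : (f : Fin n → ℕ) → ListAction.sum (map f (allFin n)) ≡ ∑[ i < n ] f i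
sum-map-allFin f = trans (cong ListAction.sum (map-tabulate id f)) (sum-tabulate f)

∑-≤ : ∀ {n} {f : Fin n → ℕ} {c} → (∀ i → f i ≤ c) → ∑[ i < n ] f i ≤ n * c
∑-≤ {zero} f≤c = z≤n
∑-≤ {suc n} f≤c = +-mono-≤ (f≤c _) (∑-≤ (f≤c ∘ fsuc))

δ : Fin n → Fin n → ℕ
δ a z = ind (does (z ≟ a))

δ-refl : (a : Fin n) → δ a a ≡ 1
δ-refl a = cong ind (dec-true (a ≟ a) refl)

δ-≢ : {a z : Fin n} → z ≢ a → δ a z ≡ 0
δ-≢ {a = a} {z} z≢a = cong ind (dec-false (z ≟ a) z≢a)

∑-δ : (a : Fin n) (f : Fin n → ℕ) → ∑[ z < n ] (δ a z * f z) ≡ f a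
∑-δ {suc n} fzero f =
  trans (cong₂ _+_ (+-identityʳ (f fzero)) (sum-replicate-zero n)) (+-identityʳ (f fzero))
∑-δ (fsuc a) f = ∑-δ a (f ∘ fsuc)

∑∑-distrib-+ : (f g : Fin n → Fin n → ℕ) →
  ∑[ x < n ] ∑[ y < n ] (f x y + g x y)
    ≡ ∑[ x < n ] ∑[ y < n ] f x y + ∑[ x < n ] ∑[ y < n ] g x y
∑∑-distrib-+ {n} f g = trans (sum-cong-≗ (λ x → ∑-distrib-+ (f x) (g x)))
  (∑-distrib-+ (λ x → ∑[ y < n ] f x y) (λ x → ∑[ y < n ] g x y))

∑∑-δ : (a b : Fin n) (g : Fin n → Fin n → ℕ) →
  ∑[ x < n ] ∑[ y < n ] (δ a x * (δ b y * g x y)) ≡ g a b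
∑∑-δ {n} a b g = begin
  ∑[ x < n ] ∑[ y < n ] (δ a x * (δ b y * g x y))
    ≡⟨ sum-cong-≗ (λ x → *-distribˡ-sum (δ a x) (λ y → δ b y * g x y)) ⟨
  ∑[ x < n ] (δ a x * ∑[ y < n ] (δ b y * g x y))
    ≡⟨ sum-cong-≗ (λ x → cong (δ a x *_) (∑-δ b (g x))) ⟩
  ∑[ x < n ] (δ a x * g x b)
    ≡⟨ ∑-δ a (λ x → g x b) ⟩
  g a b ∎
  where open ≡-Reasoning

data WhichEnd (a b : Fin n) : Fin n → Set where
  at-a : WhichEnd a b a
  at-b : WhichEnd a b b
  off  : ∀ {z} → z ≢ a → z ≢ b → WhichEnd a b z

whichEnd : (a b z : Fin n) → WhichEnd a b z
whichEnd a b z with z ≟ a | z ≟ b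
... | yes refl | _ = at-a
... | no _ | yes refl = at-b
... | no z≢a | no z≢b = off z≢a z≢b

transpose-matchˡ : (i j : Fin n) → PC.transpose i j i ≡ j
transpose-matchˡ i j rewrite dec-true (i ≟ i) refl = refl

transpose-matchʳ : (i j : Fin n) → PC.transpose i j j ≡ i
transpose-matchʳ i j with j ≟ i
... | yes j≡i = j≡i
... | no _ rewrite dec-true (j ≟ j) refl = refl

transpose-fix : {i j k : Fin n} → k ≢ i → k ≢ j → PC.transpose i j k ≡ k
transpose-fix {i = i} {j} {k} k≢i k≢j rewrite dec-false (k ≟ i) k≢i | dec-false (k ≟ j) k≢j = refl

transpose-involutive : (i j k : Fin n) → PC.transpose i j (PC.transpose i j k) ≡ k
transpose-involutive i j k with whichEnd i j k
... | at-a = trans (cong (PC.transpose i j) (transpose-matchˡ i j)) (transpose-matchʳ i j)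
... | at-b = trans (cong (PC.transpose i j) (transpose-matchʳ i j)) (transpose-matchˡ i j)
... | off k≢i k≢j =
  trans (cong (PC.transpose i j) (transpose-fix k≢i k≢j)) (transpose-fix k≢i k≢j)

entry : Digraph n → Fin n → Fin n → Bool
entry D s t = lookup (lookup D s) t

relabel : (Fin n → Fin n) → Digraph n → Digraph n
relabel f D = tabulate λ s → tabulate λ t → entry D (f s) (f t)

entry-relabel : (f : Fin n → Fin n) (D : Digraph n) (s t : Fin n) →
  entry (relabel f D) s t ≡ entry D (f s) (f t)
entry-relabel f D s t = trans (cong (λ row → lookup row t) (lookup∘tabulate _ s)) (lookup∘tabulate _ t)

module _ (f : Fin n → Fin n) (D : Digraph n) {s t : Fin n} where

  Edge-relabel⁺ : Edge D (f s) (f t) → Edge (relabel f D) s t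
  Edge-relabel⁺ = trans (entry-relabel f D s t)

  Edge-relabel⁻ : Edge (relabel f D) s t → Edge D (f s) (f t)
  Edge-relabel⁻ = trans (sym (entry-relabel f D s t))

relabel-inverse : {f g : Fin n → Fin n} → (∀ s → g (f s) ≡ s) →
  (D : Digraph n) → relabel f (relabel g D) ≡ D
relabel-inverse {f = f} {g} gf D = trans
  (tabulate-cong λ s → trans
    (tabulate-cong λ t → trans (entry-relabel g D (f s) (f t)) (cong₂ (entry D) (gf s) (gf t)))
    (tabulate∘lookup (lookup D s)))
  (tabulate∘lookup D)

module _ (π : Permutation n n) {D : Digraph n} where

  private
    σ σ⁻¹ : Fin n → Fin n
    σ = π ⟨$⟩ʳ_
    σ⁻¹ = π ⟨$⟩ˡ_

  relabel-IsTournament : IsTournament D → IsTournament (relabel σ D)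
  relabel-IsTournament (loopless , oriented) =
    (λ s → loopless (σ s) ∘ Edge-relabel⁻ σ D) ,
    (λ s t s≢t → Sum.map (orient s t) (orient t s) (oriented (σ s) (σ t) (s≢t ∘ σ-injective)))
    where
    σ-injective : ∀ {s t} → σ s ≡ σ t → s ≡ t
    σ-injective e = trans (sym (inverseˡ π)) (trans (cong σ⁻¹ e) (inverseˡ π))
    orient : ∀ s t → Edge D (σ s) (σ t) × ¬ Edge D (σ t) (σ s)
      → Edge (relabel σ D) s t × ¬ Edge (relabel σ D) t s
    orient s t (st , ¬ts) = Edge-relabel⁺ σ D st , ¬ts ∘ Edge-relabel⁻ σ D

  relabel-StronglyConnected : StronglyConnected D → StronglyConnected (relabel σ D)
  relabel-StronglyConnected connected s t =
    subst₂ (Path _) (inverseˡ π) (inverseˡ π) (relabel-Path (connected (σ s) (σ t)))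
    where
    relabel-Path : ∀ {x y} → Path D x y → Path (relabel σ D) (σ⁻¹ x) (σ⁻¹ y)
    relabel-Path here = here
    relabel-Path (step xy p) = step (Edge-relabel⁺ σ D xy′) (relabel-Path p)
      where
      xy′ : Edge D (σ (σ⁻¹ _)) (σ (σ⁻¹ _))
      xy′ = subst₂ (Edge D) (sym (inverseʳ π)) (sym (inverseʳ π)) xy

IsTournament⇒asymmetric : {D : Digraph n} {s t : Fin n} → IsTournament D → Edge D s t → ¬ Edge D t s
IsTournament⇒asymmetric {s = s} {t} (loopless , oriented) st ts with s ≟ t
... | yes refl = loopless s st
... | no s≢t = [ (λ (_ , ¬ts) → ¬ts ts) , (λ (_ , ¬st) → ¬st st) ]′ (oriented s t s≢t)

IsTournament⇒total : {D : Digraph n} {s t : Fin n} →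
  IsTournament D → s ≢ t → ¬ Edge D s t → Edge D t s
IsTournament⇒total {s = s} {t} (_ , oriented) s≢t ¬st =
  [ (λ (st , _) → contradiction st ¬st) , proj₁ ]′ (oriented s t s≢t)

descentBy : (Fin n → Fin n) → Digraph n → Fin n → Fin n → ℕ
descentBy ρ D s t = ind ((toℕ (ρ t) <ᵇ toℕ (ρ s)) ∧ entry D s t)

des-∑ : (D : Digraph n) → des D ≡ ∑[ s < n ] ∑[ t < n ] descentBy id D s t
des-∑ {n} D = trans
  (cong ListAction.sum (map-cong (λ s → sum-map-allFin (descentBy id D s)) (allFin n)))
  (sum-map-allFin (λ s → ∑[ t < n ] descentBy id D s t))

des-≤ : (D : Digraph n) → des D ≤ n * n
des-≤ {n} D = subst₂ _≤_ (sym (des-∑ D)) (cong (n *_) (*-identityʳ n))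
  (∑-≤ {f = λ s → ∑[ t < n ] descentBy id D s t}
    (λ s → ∑-≤ {f = descentBy id D s} (λ t → ind-≤ _)))

des-relabel : (π : Permutation n n) (D : Digraph n) →
  des (relabel (π ⟨$⟩ʳ_) D) ≡ ∑[ x < n ] ∑[ y < n ] descentBy (π ⟨$⟩ˡ_) D x y
des-relabel {n} π D = begin
  des (relabel σ D)
    ≡⟨ des-∑ (relabel σ D) ⟩
  ∑[ s < n ] ∑[ t < n ] descentBy id (relabel σ D) s t
    ≡⟨ sum-cong-≗ (λ s → sum-cong-≗ (pulled-back s)) ⟩
  ∑[ s < n ] ∑[ t < n ] descentBy σ⁻¹ D (σ s) (σ t)
    ≡⟨ sum-cong-≗ (λ s → ∑-permute (descentBy σ⁻¹ D (σ s)) π) ⟨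
  ∑[ s < n ] ∑[ y < n ] descentBy σ⁻¹ D (σ s) y
    ≡⟨ ∑-permute (λ x → ∑[ y < n ] descentBy σ⁻¹ D x y) π ⟨
  ∑[ x < n ] ∑[ y < n ] descentBy σ⁻¹ D x y ∎
  where
  open ≡-Reasoning
  σ σ⁻¹ : Fin n → Fin n
  σ = π ⟨$⟩ʳ_
  σ⁻¹ = π ⟨$⟩ˡ_
  pulled-back : ∀ s t → descentBy id (relabel σ D) s t ≡ descentBy σ⁻¹ D (σ s) (σ t)
  pulled-back s t = cong ind (cong₂ _∧_
    (sym (cong₂ (λ u v → toℕ u <ᵇ toℕ v) (inverseˡ π) (inverseˡ π))) (entry-relabel σ D s t))

module _ {a b : Fin n} (adjacent : toℕ b ≡ suc (toℕ a)) where

  private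
    τ : Fin n → Fin n
    τ = PC.transpose b a

    a<b : toℕ a < toℕ b
    a<b = ≤-reflexive (sym adjacent)

    a≢b : a ≢ b
    a≢b = <⇒≢ a<b

    b≢a : b ≢ a
    b≢a = a≢b ∘ sym

    <b⇒<a : ∀ {z} → z ≢ a → toℕ z < toℕ b → toℕ z < toℕ a
    <b⇒<a z≢a z<b = ≤∧≢⇒< (s≤s⁻¹ (subst (_ <_) adjacent z<b)) (z≢a ∘ toℕ-injective)

    a<⇒b< : ∀ {z} → z ≢ b → toℕ a < toℕ z → toℕ b < toℕ z
    a<⇒b< z≢b a<z = ≤∧≢⇒< (subst (_≤ _) (sym adjacent) a<z) (z≢b ∘ sym ∘ toℕ-injective)

    factor : ∀ u v w e → u * e + v * (w * e) ≡ (u + v * w) * e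
    factor u v w e = trans (cong (_+_ (u * e)) (sym (*-assoc v w e))) (sym (*-distribʳ-+ e u (v * w)))

  -- τ preserves the order of each pair of vertices except {a, b}; the δ terms account for the
  -- ordered pairs (b, a) and (a, b).
  transpose-adjacent-<ᵇ : ∀ x y →
    ind (toℕ (τ y) <ᵇ toℕ (τ x)) + δ b x * δ a y ≡ ind (toℕ y <ᵇ toℕ x) + δ a x * δ b y
  transpose-adjacent-<ᵇ x y with whichEnd a b x | whichEnd a b y
  ... | at-a | at-a rewrite transpose-matchʳ b a | δ-≢ a≢b | δ-refl a
        | <ᵇ-irrefl (toℕ a) | <ᵇ-irrefl (toℕ b) = refl
  ... | at-a | at-b rewrite transpose-matchˡ b a | transpose-matchʳ b a | δ-≢ a≢b
        | δ-refl a | δ-refl b | <ᵇ-true a<b | <ᵇ-false (<⇒≯ a<b) = refl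
  ... | at-a | off y≢a y≢b rewrite transpose-fix y≢b y≢a | transpose-matchʳ b a
        | δ-≢ a≢b | δ-≢ y≢b | δ-refl a =
    cong (λ β → ind β + 0) (<ᵇ-cong (<b⇒<a y≢a) (λ y<a → <-trans y<a a<b))
  ... | at-b | at-a rewrite transpose-matchˡ b a | transpose-matchʳ b a | δ-≢ a≢b | δ-≢ b≢a
        | δ-refl a | δ-refl b | <ᵇ-true a<b | <ᵇ-false (<⇒≯ a<b) = refl
  ... | at-b | at-b rewrite transpose-matchˡ b a | δ-≢ b≢a | δ-refl b
        | <ᵇ-irrefl (toℕ a) | <ᵇ-irrefl (toℕ b) = refl
  ... | at-b | off y≢a y≢b rewrite transpose-fix y≢b y≢a | transpose-matchˡ b a
        | δ-≢ b≢a | δ-≢ y≢a | δ-refl b =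
    cong (λ β → ind β + 0) (<ᵇ-cong (λ y<a → <-trans y<a a<b) (<b⇒<a y≢a))
  ... | off x≢a x≢b | at-a rewrite transpose-fix x≢b x≢a | transpose-matchʳ b a
        | δ-≢ x≢a | δ-≢ x≢b =
    cong (λ β → ind β + 0) (<ᵇ-cong (<-trans a<b) (a<⇒b< x≢b))
  ... | off x≢a x≢b | at-b rewrite transpose-fix x≢b x≢a | transpose-matchˡ b a
        | δ-≢ x≢a | δ-≢ x≢b =
    cong (λ β → ind β + 0) (<ᵇ-cong (a<⇒b< x≢b) (<-trans a<b))
  ... | off x≢a x≢b | off y≢a y≢b rewrite transpose-fix x≢b x≢a | transpose-fix y≢b y≢a
        | δ-≢ x≢a | δ-≢ x≢b = refl

  descentBy-transpose-adjacent : ∀ D x y →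
    descentBy τ D x y + δ b x * (δ a y * ind (entry D x y))
      ≡ descentBy id D x y + δ a x * (δ b y * ind (entry D x y))
  descentBy-transpose-adjacent D x y = begin
    descentBy τ D x y + δ b x * (δ a y * e)
      ≡⟨ cong (_+ δ b x * (δ a y * e)) (ind-∧ τy<τx (entry D x y)) ⟩
    ind τy<τx * e + δ b x * (δ a y * e)
      ≡⟨ factor (ind τy<τx) (δ b x) (δ a y) e ⟩
    (ind τy<τx + δ b x * δ a y) * e
      ≡⟨ cong (_* e) (transpose-adjacent-<ᵇ x y) ⟩
    (ind y<x + δ a x * δ b y) * e
      ≡⟨ factor (ind y<x) (δ a x) (δ b y) e ⟨
    ind y<x * e + δ a x * (δ b y * e)
      ≡⟨ cong (_+ δ a x * (δ b y * e)) (ind-∧ y<x (entry D x y)) ⟨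
    descentBy id D x y + δ a x * (δ b y * e) ∎
    where
    open ≡-Reasoning
    τy<τx y<x : Bool
    τy<τx = toℕ (τ y) <ᵇ toℕ (τ x)
    y<x = toℕ y <ᵇ toℕ x
    e : ℕ
    e = ind (entry D x y)

  des-transpose-adjacent : (D : Digraph n) →
    des (relabel (PC.transpose a b) D) + ind (entry D b a) ≡ des D + ind (entry D a b)
  des-transpose-adjacent D = begin
    des (relabel (PC.transpose a b) D) + ind (entry D b a)
      ≡⟨ cong₂ _+_ (des-relabel (Perm.transpose a b) D) (sym (∑∑-δ b a e)) ⟩
    ∑∑ (descentBy τ D) + ∑∑ (λ x y → δ b x * (δ a y * e x y))
      ≡⟨ ∑∑-distrib-+ (descentBy τ D) _ ⟨
    ∑∑ (λ x y → descentBy τ D x y + δ b x * (δ a y * e x y))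
      ≡⟨ sum-cong-≗ (λ x → sum-cong-≗ (descentBy-transpose-adjacent D x)) ⟩
    ∑∑ (λ x y → descentBy id D x y + δ a x * (δ b y * e x y))
      ≡⟨ ∑∑-distrib-+ (descentBy id D) _ ⟩
    ∑∑ (descentBy id D) + ∑∑ (λ x y → δ a x * (δ b y * e x y))
      ≡⟨ cong₂ _+_ (sym (des-∑ D)) (∑∑-δ a b e) ⟩
    des D + ind (entry D a b) ∎
    where
    open ≡-Reasoning
    e : Fin n → Fin n → ℕ
    e x y = ind (entry D x y)
    ∑∑ : (Fin n → Fin n → ℕ) → ℕ
    ∑∑ f = ∑[ x < n ] ∑[ y < n ] f x y

record AdjacentPair (n : ℕ) : Set where
  field
    low high : Fin n
    adjacent : toℕ high ≡ suc (toℕ low)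

open AdjacentPair

Ascending : AdjacentPair n → Digraph n → Set
Ascending p D = Edge D (low p) (high p)

_Above_ : AdjacentPair n → AdjacentPair n → Set
p Above q = toℕ (high q) < toℕ (low p)

swap : AdjacentPair n → Digraph n → Digraph n
swap p = relabel (PC.transpose (low p) (high p))

module _ (p : AdjacentPair n) where

  low<high : toℕ (low p) < toℕ (high p)
  low<high = ≤-reflexive (sym (adjacent p))

  swap-involutive : (D : Digraph n) → swap p (swap p D) ≡ D
  swap-involutive = relabel-inverse (transpose-involutive (low p) (high p))

module _ (p : AdjacentPair n) (D : Digraph n) where

  swap-IsTournament : IsTournament D → IsTournament (swap p D)
  swap-IsTournament = relabel-IsTournament (Perm.transpose (low p) (high p)) {D}

  swap-StronglyConnected : StronglyConnected D → StronglyConnected (swap p D)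
  swap-StronglyConnected = relabel-StronglyConnected (Perm.transpose (low p) (high p)) {D}

  entry-swap : entry (swap p D) (low p) (high p) ≡ entry D (high p) (low p)
  entry-swap = trans (entry-relabel _ D (low p) (high p))
    (cong₂ (entry D) (transpose-matchˡ (low p) (high p)) (transpose-matchʳ (low p) (high p)))

  swap-Ascending-below : {q : AdjacentPair n} → p Above q → Ascending q D → Ascending q (swap p D)
  swap-Ascending-below {q} q<p asc =
    Edge-relabel⁺ _ D (subst₂ (Edge D) (sym (fixed (low q) low<p)) (sym (fixed (high q) q<p)) asc)
    where
    low<p : toℕ (low q) < toℕ (low p)
    low<p = <-trans (low<high q) q<p
    fixed : ∀ z → toℕ z < toℕ (low p) → PC.transpose (low p) (high p) z ≡ z
    fixed z z<p = transpose-fix (<⇒≢ z<p) (<⇒≢ (<-trans z<p (low<high p)))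

  des-swap : IsTournament D → Ascending p D → des (swap p D) ≡ suc (des D)
  des-swap T asc = begin
    des (swap p D)                                  ≡⟨ +-identityʳ _ ⟨
    des (swap p D) + 0                              ≡⟨ cong (λ b → des (swap p D) + ind b) reversed ⟨
    des (swap p D) + ind (entry D (high p) (low p)) ≡⟨ des-transpose-adjacent (adjacent p) D ⟩
    des D + ind (entry D (low p) (high p))          ≡⟨ cong (λ b → des D + ind b) asc ⟩
    des D + 1                                       ≡⟨ +-comm (des D) 1 ⟩
    suc (des D)                                     ∎
    where
    open ≡-Reasoning
    reversed : entry D (high p) (low p) ≡ false
    reversed = Bool.¬-not (IsTournament⇒asymmetric {D = D} T asc)

  swap-¬Ascending : IsTournament D → ¬ Ascending p D → Ascending p (swap p D)
  swap-¬Ascending T ¬asc = trans entry-swap (IsTournament⇒total {D = D} T (<⇒≢ (low<high p)) ¬asc)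

StrongTournament : ℕ → Digraph n → Set
StrongTournament k D = IsTournament D × StronglyConnected D × des D ≡ k

AscendingOn : List (AdjacentPair n) → Digraph n → Set
AscendingOn ps D = All (λ p → Ascending p D) ps

ascending? : (p : AdjacentPair n) → Decidable (Ascending p)
ascending? p D = entry D (low p) (high p) Bool.≟ true

ascendingOn? : (ps : List (AdjacentPair n)) → Decidable (AscendingOn ps)
ascendingOn? ps D = All.all? (λ p → ascending? p D) ps

swap-AscendingOn : (p : AdjacentPair n) (D : Digraph n) {ps : List (AdjacentPair n)}
  → All (p Above_) ps → AscendingOn ps D → AscendingOn ps (swap p D)
swap-AscendingOn p D [] [] = []
swap-AscendingOn p D {q ∷ _} (q<p ∷ above) (asc ∷ ascs) =
  swap-Ascending-below p D {q} q<p asc ∷ swap-AscendingOn p D above ascs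

des-¬Ascending : (p : AdjacentPair n) (D : Digraph n) → IsTournament D → ¬ Ascending p D
  → des D ≡ suc (des (swap p D))
des-¬Ascending p D T ¬asc = trans (cong des (sym (swap-involutive p D)))
  (des-swap p (swap p D) (swap-IsTournament p D T) (swap-¬Ascending p D T ¬asc))

module _ {p : AdjacentPair n} {ps : List (AdjacentPair n)} (p-above : All (p Above_) ps) where

  swap-to-descending : ∀ {k D} → StrongTournament k D × AscendingOn (p ∷ ps) D
    → (StrongTournament (suc k) (swap p D) × AscendingOn ps (swap p D)) × ¬ Ascending p (swap p D)
  swap-to-descending {D = D} ((T , C , refl) , asc ∷ ascs) =
    (  (swap-IsTournament p D T , swap-StronglyConnected p D C , des-swap p D T asc)
    , swap-AscendingOn p D p-above ascs)
    , IsTournament⇒asymmetric {D = D} T asc ∘ trans (sym (entry-swap p D))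

  swap-to-ascending : ∀ {k D} → (StrongTournament (suc k) D × AscendingOn ps D) × ¬ Ascending p D
    → StrongTournament k (swap p D) × AscendingOn (p ∷ ps) (swap p D)
  swap-to-ascending {D = D} (((T , C , d) , ascs) , ¬asc) =
    (  swap-IsTournament p D T , swap-StronglyConnected p D C
    , suc-injective (trans (sym (des-¬Ascending p D T ¬asc)) d))
    , swap-¬Ascending p D T ¬asc ∷ swap-AscendingOn p D p-above ascs

shift : (ℕ → ℕ) → ℕ → ℕ
shift c zero = 0
shift c (suc k) = c k

HasCoefficients : List ℤ → (ℕ → ℕ) → Set
HasCoefficients q c = ∀ k → coef q k ≡ + c k

coef-+ₚ : (q r : List ℤ) (k : ℕ) → coef (q +ₚ r) k ≡ coef q k +ℤ coef r k
coef-+ₚ [] r k = sym (+ℤ-identityˡ (coef r k))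
coef-+ₚ (a ∷ q) [] k = sym (+ℤ-identityʳ (coef (a ∷ q) k))
coef-+ₚ (a ∷ q) (b ∷ r) zero = refl
coef-+ₚ (a ∷ q) (b ∷ r) (suc k) = coef-+ₚ q r k

mul1+u-HasCoefficients : ∀ {q c} →
  HasCoefficients q c → HasCoefficients (mul1+u q) (λ k → c k + shift c k)
mul1+u-HasCoefficients {q} {c} q~c k = begin
  coef (q +ₚ (+ 0 ∷ q)) k       ≡⟨ coef-+ₚ q (+ 0 ∷ q) k ⟩
  coef q k +ℤ coef (+ 0 ∷ q) k  ≡⟨ cong₂ _+ℤ_ (q~c k) (shifted k) ⟩
  + c k +ℤ + shift c k          ≡⟨ pos-+ (c k) (shift c k) ⟨
  + (c k + shift c k)           ∎
  where
  open ≡-Reasoning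
  shifted : ∀ k → coef (+ 0 ∷ q) k ≡ + shift c k
  shifted zero = refl
  shifted (suc k) = q~c k

mul[1+u]^-suc : ∀ m q → mul[1+u]^ (suc m) q ≡ mul[1+u]^ m (mul1+u q)
mul[1+u]^-suc zero q = refl
mul[1+u]^-suc (suc m) q = cong mul1+u (mul[1+u]^-suc m q)

fromCoefficients : (ℕ → ℕ) → ℕ → List ℤ
fromCoefficients c zero = []
fromCoefficients c (suc N) = + c 0 ∷ fromCoefficients (c ∘ suc) N

fromCoefficients-HasCoefficients : ∀ {c} N → (∀ k → N ≤ k → c k ≡ 0) →
  HasCoefficients (fromCoefficients c N) c
fromCoefficients-HasCoefficients zero vanish k = sym (cong +_ (vanish k z≤n))
fromCoefficients-HasCoefficients (suc N) vanish zero = refl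
fromCoefficients-HasCoefficients (suc N) vanish (suc k) =
  fromCoefficients-HasCoefficients N (λ k N≤k → vanish (suc k) (s≤s N≤k)) k

module _ {n : ℕ} {t : ℕ → ℕ} (t-counts : ∀ k → IsCount (StrongTournament {n} k) (t k)) where

  count : List (AdjacentPair n) → ℕ → ℕ
  count ps k = proj₁ (IsCount-∩ (ascendingOn? ps) (t-counts k))

  count-IsCount : ∀ ps k → IsCount (λ D → StrongTournament k D × AscendingOn ps D) (count ps k)
  count-IsCount ps k = proj₂ (IsCount-∩ (ascendingOn? ps) (t-counts k))

  count-[] : ∀ k → count [] k ≡ t k
  count-[] k =
    IsCount-unique (count-IsCount [] k) (IsCount-resp (λ D → mk⇔ (_, []) proj₁) (t-counts k))

  count-vanishes : ∀ ps k → n * n < k → count ps k ≡ 0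
  count-vanishes ps k n*n<k = IsCount-unique (count-IsCount ps k)
    (IsCount-∅ (λ D ((_ , _ , d) , _) → <⇒≱ n*n<k (subst (_≤ n * n) d (des-≤ D))))

  module _ {p : AdjacentPair n} {ps : List (AdjacentPair n)} (p-above : All (p Above_) ps) where

    count-ascending : ∀ k →
      IsCount (λ D → (StrongTournament k D × AscendingOn ps D) × Ascending p D) (count (p ∷ ps) k)
    count-ascending k = IsCount-resp
      (λ D → mk⇔ (λ (s , ascs) → (s , All.tail ascs) , All.head ascs)
                 (λ ((s , ascs) , asc) → s , asc ∷ ascs))
      (count-IsCount (p ∷ ps) k)

    count-descending : ∀ k →
      IsCount (λ D → (StrongTournament k D × AscendingOn ps D) × ¬ Ascending p D)
              (shift (count (p ∷ ps)) k)
    count-descending zero =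
      IsCount-∅ (λ D (((T , _ , d) , _) , ¬asc) → 0≢1+n (trans (sym d) (des-¬Ascending p D T ¬asc)))
    count-descending (suc k) = IsCount-bijection (swap p) (swap p) (swap-involutive p) (swap-involutive p)
      (swap-to-descending p-above) (swap-to-ascending p-above) (count-IsCount (p ∷ ps) k)

    count-recurrence : ∀ k → count ps k ≡ count (p ∷ ps) k + shift (count (p ∷ ps)) k
    count-recurrence k =
      IsCount-split (ascending? p) (count-IsCount ps k) (count-ascending k) (count-descending k)

  count-HasCoefficients : ∀ ps {q} → AllPairs _Above_ ps → HasCoefficients q (count ps)
    → HasCoefficients (mul[1+u]^ (length ps) q) (count [])
  count-HasCoefficients [] [] q~c = q~c
  count-HasCoefficients (p ∷ ps) {q} (p-above ∷ sorted) q~c k = trans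
    (cong (λ r → coef r k) (mul[1+u]^-suc (length ps) q))
    (count-HasCoefficients ps sorted [1+u]q~c k)
    where
    [1+u]q~c : HasCoefficients (mul1+u q) (count ps)
    [1+u]q~c k = trans (mul1+u-HasCoefficients {q} q~c k) (cong +_ (sym (count-recurrence p-above k)))

lowerPairs : (m : ℕ) → m * 2 ≤ n → List (AdjacentPair n)
lowerPairs zero _ = []
lowerPairs (suc m) h = pair ∷ lowerPairs m (<⇒≤ (<⇒≤ h))
  where
  pair : AdjacentPair _
  pair = record
    { low = fromℕ< (<⇒≤ h)
    ; high = fromℕ< h
    ; adjacent = trans (toℕ-fromℕ< h) (cong suc (sym (toℕ-fromℕ< (<⇒≤ h))))
    }

length-lowerPairs : ∀ m (h : m * 2 ≤ n) → length (lowerPairs m h) ≡ m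
length-lowerPairs zero _ = refl
length-lowerPairs (suc m) h = cong suc (length-lowerPairs m _)

lowerPairs-below : ∀ m (h : m * 2 ≤ n) → All (λ q → toℕ (high q) < m * 2) (lowerPairs m h)
lowerPairs-below zero _ = []
lowerPairs-below (suc m) h =
  subst (_< suc m * 2) (sym (toℕ-fromℕ< h)) (n<1+n _)
  ∷ All.map (λ q<m*2 → <-trans q<m*2 (m<n⇒m<1+n (n<1+n _))) (lowerPairs-below m _)

lowerPairs-sorted : ∀ m (h : m * 2 ≤ n) → AllPairs _Above_ (lowerPairs m h)
lowerPairs-sorted zero _ = []
lowerPairs-sorted (suc m) h =
  All.map (subst (_ <_) (sym (toℕ-fromℕ< (<⇒≤ h)))) (lowerPairs-below m _)
  ∷ lowerPairs-sorted m _

proposition3p3 : (n : ℕ) → 1 ≤ n → (t : ℕ → ℕ)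
    → (∀ k → IsCount (λ (D : Digraph n) → IsTournament D × StronglyConnected D × des D ≡ k) (t k))
    → Σ (List ℤ) λ q → ∀ k → coef (mul[1+u]^ (n / 2) q) k ≡ + (t k)
proposition3p3 n _ t t-counts = q , λ k → begin
  coef (mul[1+u]^ (n / 2) q) k
    ≡⟨ cong (λ m → coef (mul[1+u]^ m q) k) (length-lowerPairs (n / 2) half) ⟨
  coef (mul[1+u]^ (length pairs) q) k
    ≡⟨ count-HasCoefficients t-counts pairs (lowerPairs-sorted (n / 2) half) q~c k ⟩
  + count t-counts [] k
    ≡⟨ cong +_ (count-[] t-counts k) ⟩
  + t k ∎
  where
  open ≡-Reasoning
  half : n / 2 * 2 ≤ n
  half = m/n*n≤m n 2
  pairs : List (AdjacentPair n)
  pairs = lowerPairs (n / 2) half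
  q : List ℤ
  q = fromCoefficients (count t-counts pairs) (suc (n * n))
  q~c : HasCoefficients q (count t-counts pairs)
  q~c = fromCoefficients-HasCoefficients (suc (n * n)) (count-vanishes t-counts pairs)
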